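{- Let $F$ be a graph of diameter $2$ with $n=|V(F)|$ and minimum degree $t=\delta(F)$, and let $l>n$ be an integer. Let $F_{2l}$ be the graph with vertex set $\{1,2,\dots,2l\}$ whose edges are all pairs $(i,j)$ with $i\ne j$, $i,j\in\{1,\dots,2l-1\}$, $|i-j|\le l-1$, together with the edges $(1,2l),\dots,(t,2l)$. Let $X$ be the subgraph of $F_{2l}$ induced by $\{1,2,\dots,l+t-1\}\cup\{2l\}$. Then every subgraph $Y$ of $F_{2l}$ that is isomorphic to $F$ and contains the vertex $2l$ satisfies: (1) $(1,2l),(2,2l),\dots,(t,2l)\in E(Y)$; (2) $Y$ is a subgraph of $X$.
   Context: All graphs are finite, simple and undirected. $\delta(F)$ denotes the minimum vertex degree of $F$. -}

module Defs where

open import Data.Nat using (ℕ; zero; suc; _+_; _*_; _∸_; _≤_; _<_; _≤ᵇ_; ∣_-_∣)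
open import Data.Nat.Base using () renaming (_≡ᵇ_ to _==_)
open import Data.Bool using (Bool; true; false; _∧_; _∨_; not)
open import Data.Fin using (Fin; toℕ)
open import Data.List using (length; filterᵇ; allFin)
open import Data.Product using (Σ; ∃; _×_; _,_)
open import Data.Sum using (_⊎_)
open import Relation.Nullary using (¬_)
open import Relation.Binary.PropositionalEquality using (_≡_; _≢_)
open import Function.Definitions using (Injective)

record Graph : Set where
  field
    size : ℕ
    adj  : Fin size → Fin size → Bool
open Graph public

Adj : (G : Graph) → Fin (size G) → Fin (size G) → Set
Adj G u v = adj G u v ≡ true

IsSimple : Graph → Set
IsSimple G = (∀ u v → adj G u v ≡ adj G v u) × (∀ u → adj G u u ≡ false)

degree : (G : Graph) → Fin (size G) → ℕ
degree G v = length (filterᵇ (adj G v) (allFin (size G)))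

MinDegree : Graph → ℕ → Set
MinDegree G t = (∀ v → t ≤ degree G v) × (∃ λ v → degree G v ≡ t)

data Walk (G : Graph) : Fin (size G) → Fin (size G) → ℕ → Set where
  here : ∀ {u} → Walk G u u zero
  step : ∀ {u w v k} → Adj G u w → Walk G w v k → Walk G u v (suc k)

DistLe : (G : Graph) → Fin (size G) → Fin (size G) → ℕ → Set
DistLe G u v k = Σ ℕ λ j → j ≤ k × Walk G u v j

Diameter2 : Graph → Set
Diameter2 G = (∀ u v → DistLe G u v 2) × (∃ λ u → ∃ λ v → ¬ DistLe G u v 1)

-- The graph F_{2l} (parameter t). Vertex i : Fin (2l) stands for the label toℕ i + 1 ∈ {1,…,2l}.
label : ∀ {m} → Fin m → ℕ
label i = suc (toℕ i)

FAdjℕ : ℕ → ℕ → ℕ → ℕ → Bool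
FAdjℕ l t a b =
  not (a == b) ∧
  ( ((a ≤ᵇ (2 * l ∸ 1)) ∧ (b ≤ᵇ (2 * l ∸ 1)) ∧ (∣ a - b ∣ ≤ᵇ (l ∸ 1)))
  ∨ ((a ≤ᵇ t) ∧ (b == 2 * l))
  ∨ ((b ≤ᵇ t) ∧ (a == 2 * l)))

F2l : ℕ → ℕ → Graph
F2l l t = record { size = 2 * l ; adj = λ i j → FAdjℕ l t (label i) (label j) }

record Subgraph (G : Graph) : Set where
  field
    inV : Fin (size G) → Bool
    inE : Fin (size G) → Fin (size G) → Bool
    inE-sym : ∀ u v → inE u v ≡ inE v u
    inE⊆E   : ∀ u v → inE u v ≡ true → adj G u v ≡ true
    inE-ends : ∀ u v → inE u v ≡ true → (inV u ≡ true) × (inV v ≡ true)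
open Subgraph public

Iso : (F : Graph) {G : Graph} → Subgraph G → Set
Iso F {G} Y = Σ (Fin (size F) → Fin (size G)) λ f →
    Injective _≡_ _≡_ f
  × (∀ u → inV Y (f u) ≡ true)
  × (∀ v → inV Y v ≡ true → ∃ λ u → f u ≡ v)
  × (∀ u w → adj F u w ≡ inE Y (f u) (f w))

{-# OPTIONS --safe #-}
-- Let u₀ be the vertex of F sent to 2l. Its at least t neighbours are sent injectively into
-- the neighbourhood {1,…,t} of 2l in F_{2l}, so by pigeonhole they fill it: this is (1).
-- Every vertex of F is within distance 2 of u₀, and a vertex of F_{2l} within distance 2 of 2l
-- is 2l itself or a neighbour of some k ≤ t, hence has label at most t + (l − 1): this is (2).
module Submission where

open import Defs
open import Data.Nat using (ℕ; zero; suc; _+_; _*_; _∸_; _≤_; _<_; _≤ᵇ_; ∣_-_∣; z≤n; s≤s)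
open import Data.Nat.Base using () renaming (_≡ᵇ_ to _==_)
open import Data.Nat.Properties
  using (_≟_; ≤-trans; ≤-reflexive; ≤⇒≯; ≤∧≢⇒<; m<1+n⇒m≤n; <-irrefl; m<n⇒0<n; ≤ᵇ⇒≤; ≡ᵇ⇒≡; ≡⇒≡ᵇ;
         suc-injective; +-comm; +-mono-≤; m≤n+m; m≤n+∣n-m∣; module ≤-Reasoning)
open import Data.Bool using (true; false; not; _∧_; _∨_; T)
open import Data.Bool.Properties using (T-≡)
open import Data.Fin using (Fin; toℕ)
open import Data.Fin.Properties using (toℕ-injective)
open import Data.List using (List; []; _∷_; length; map; filter; filterᵇ; allFin)
open import Data.List.Properties using (length-map; filter-all; filter-accept; filter-reject)
open import Data.List.Membership.Propositional using (_∈_)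
open import Data.List.Membership.Propositional.Properties using (∈-map⁻; ∈-filter⁻)
open import Data.List.Membership.DecPropositional _≟_ using (_∈?_)
open import Data.List.Relation.Unary.All as All using (All; []; _∷_)
open import Data.List.Relation.Unary.All.Properties using (all-filter; filter⁺; ¬Any⇒All¬)
open import Data.List.Relation.Unary.AllPairs using ([]; _∷_)
open import Data.List.Relation.Unary.Unique.Propositional using (Unique)
import Data.List.Relation.Unary.Unique.Propositional.Properties as Unique
open import Data.Product using (_×_; _,_; proj₁; proj₂; ∃)
open import Data.Sum using (_⊎_; inj₁; inj₂)
open import Function using (_∘_)
open import Function.Bundles using (Equivalence)
open import Function.Definitions using (Injective)
open import Relation.Nullary using (¬_; ¬?; yes; no; contradiction)
open import Relation.Nullary.Decidable using (T?)
open import Relation.Binary.Definitions using (Decidable)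
open import Relation.Binary.PropositionalEquality
  using (_≡_; _≢_; refl; sym; trans; cong; ≢-sym; module ≡-Reasoning)

open Equivalence using (to; from)

_≢?_ : Decidable {A = ℕ} _≢_
x ≢? k = ¬? (x ≟ k)

filter≢ : ℕ → List ℕ → List ℕ
filter≢ k = filter (_≢? k)

length≤1+length-filter≢ : ∀ k {xs} → Unique xs → length xs ≤ suc (length (filter≢ k xs))
length≤1+length-filter≢ k {[]} [] = z≤n
length≤1+length-filter≢ k {x ∷ xs} (x∉xs ∷ xs!) with x ≟ k
... | yes refl = s≤s (≤-reflexive (sym (begin
  length (filter≢ x (x ∷ xs)) ≡⟨ cong length (filter-reject (_≢? x) (λ x≢x → x≢x refl)) ⟩
  length (filter≢ x xs)       ≡⟨ cong length (filter-all (_≢? x) (All.map ≢-sym x∉xs)) ⟩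
  length xs                   ∎)))
  where open ≡-Reasoning
... | no x≢k = ≤-trans (s≤s (length≤1+length-filter≢ k xs!))
  (≤-reflexive (cong (suc ∘ length) (sym (filter-accept (_≢? k) x≢k))))

All<-filter≢ : ∀ k {xs} → All (_< suc k) xs → All (_< k) (filter≢ k xs)
All<-filter≢ k {xs} xs≤k = All.zipWith (λ (x≤k , x≢k) → ≤∧≢⇒< (m<1+n⇒m≤n x≤k) x≢k)
  (filter⁺ (_≢? k) xs≤k , all-filter (_≢? k) xs)

Unique∧All<⇒length≤ : ∀ t {xs} → Unique xs → All (_< t) xs → length xs ≤ t
Unique∧All<⇒length≤ zero {[]} _ _ = z≤n
Unique∧All<⇒length≤ zero {_ ∷ _} _ (() ∷ _)
Unique∧All<⇒length≤ (suc t) xs! xs<1+t = ≤-trans (length≤1+length-filter≢ t xs!)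
  (s≤s (Unique∧All<⇒length≤ t (Unique.filter⁺ (_≢? t) xs!) (All<-filter≢ t xs<1+t)))

Unique∧All<∧length≥⇒∈ : ∀ {t xs k} → Unique xs → All (_< t) xs → t ≤ length xs → k < t → k ∈ xs
Unique∧All<∧length≥⇒∈ {t} {xs} {k} xs! xs<t t≤len k<t with k ∈? xs
... | yes k∈xs = k∈xs
... | no k∉xs =
  contradiction (Unique∧All<⇒length≤ t (¬Any⇒All¬ xs k∉xs ∷ xs!) (k<t ∷ xs<t)) (≤⇒≯ t≤len)

injective-image-saturates : ∀ {A : Set} {m t} {f : A → Fin m} {xs : List A} →
  Injective _≡_ _≡_ f → Unique xs → t ≤ length xs → (∀ {x} → x ∈ xs → toℕ (f x) < t) →
  ∀ a → toℕ a < t → ∃ λ x → x ∈ xs × f x ≡ a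
injective-image-saturates {t = t} {f} {xs} f-inj xs! t≤len image<t a a<t =
  let x , x∈xs , a≡fx = ∈-map⁻ (toℕ ∘ f) (Unique∧All<∧length≥⇒∈ image! image-bounded t≤image a<t)
  in  x , x∈xs , sym (toℕ-injective a≡fx)
  where
  image : List ℕ
  image = map (toℕ ∘ f) xs
  image! : Unique image
  image! = Unique.map⁺ (f-inj ∘ toℕ-injective) xs!
  image-bounded : All (_< t) image
  image-bounded = All.tabulate λ y∈image → below (∈-map⁻ (toℕ ∘ f) y∈image)
    where
    below : ∀ {y} → ∃ (λ x → x ∈ xs × y ≡ toℕ (f x)) → y < t
    below (x , x∈xs , refl) = image<t x∈xs
  t≤image : t ≤ length image
  t≤image = ≤-trans t≤len (≤-reflexive (sym (length-map (toℕ ∘ f) xs)))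

neighbours : (G : Graph) → Fin (size G) → List (Fin (size G))
neighbours G v = filterᵇ (adj G v) (allFin (size G))

neighbours-unique : ∀ G v → Unique (neighbours G v)
neighbours-unique G v = Unique.filter⁺ (T? ∘ adj G v) (Unique.allFin⁺ (size G))

∈-neighbours⁻ : ∀ {G v w} → w ∈ neighbours G v → Adj G v w
∈-neighbours⁻ {G} {v} w∈N = to T-≡ (proj₂ (∈-filter⁻ (T? ∘ adj G v) {xs = allFin (size G)} w∈N))

IsHomomorphism : (F G : Graph) → (Fin (size F) → Fin (size G)) → Set
IsHomomorphism F G f = ∀ {u w} → Adj F u w → Adj G (f u) (f w)

Walk-map : ∀ {F G f} → IsHomomorphism F G f → ∀ {u v k} → Walk F u v k → Walk G (f u) (f v) k
Walk-map hom here = here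
Walk-map hom (step u~w walk) = step (hom u~w) (Walk-map hom walk)

DistLe-map : ∀ {F G f} → IsHomomorphism F G f → ∀ {u v k} → DistLe F u v k → DistLe G (f u) (f v) k
DistLe-map hom (j , j≤k , walk) = j , j≤k , Walk-map hom walk

Iso⇒IsHomomorphism : ∀ {F G} {Y : Subgraph G} (iso : Iso F Y) → IsHomomorphism F G (proj₁ iso)
Iso⇒IsHomomorphism {Y = Y} (f , _ , _ , _ , f-preserves) {u} {w} u~w =
  inE⊆E Y (f u) (f w) (trans (sym (f-preserves u w)) u~w)

∧-true : ∀ {x y} → x ∧ y ≡ true → x ≡ true × y ≡ true
∧-true {true} y≡true = refl , y≡true

∨-true : ∀ {x y} → x ∨ y ≡ true → x ≡ true ⊎ y ≡ true
∨-true {true}  _      = inj₁ refl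
∨-true {false} y≡true = inj₂ y≡true

not-true : ∀ {x} → not x ≡ true → ¬ T x
not-true {false} _ ()

≤ᵇ-true⇒≤ : ∀ {m n} → (m ≤ᵇ n) ≡ true → m ≤ n
≤ᵇ-true⇒≤ {m} {n} m≤ᵇn = ≤ᵇ⇒≤ m n (from T-≡ m≤ᵇn)

≡ᵇ-true⇒≡ : ∀ {m n} → (m == n) ≡ true → m ≡ n
≡ᵇ-true⇒≡ {m} {n} m≡ᵇn = ≡ᵇ⇒≡ m n (from T-≡ m≡ᵇn)

data F2lEdge (l t a b : ℕ) : Set where
  band     : a ≤ 2 * l ∸ 1 → ∣ a - b ∣ ≤ l ∸ 1 → F2lEdge l t a b
  to-top   : a ≤ t → b ≡ 2 * l → F2lEdge l t a b
  from-top : b ≤ t → a ≡ 2 * l → F2lEdge l t a b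

FAdjℕ-irrefl : ∀ l t a → FAdjℕ l t a a ≢ true
FAdjℕ-irrefl _ _ a adj = not-true (proj₁ (∧-true adj)) (≡⇒≡ᵇ a a refl)

FAdjℕ⇒F2lEdge : ∀ l t a b → FAdjℕ l t a b ≡ true → F2lEdge l t a b
FAdjℕ⇒F2lEdge _ _ _ _ adj with ∨-true (proj₂ (∧-true adj))
... | inj₁ inBand with a≤ , b≤∧close ← ∧-true inBand =
  band (≤ᵇ-true⇒≤ a≤) (≤ᵇ-true⇒≤ (proj₂ (∧-true b≤∧close)))
... | inj₂ spoke with ∨-true spoke
... | inj₁ spokeᵃ with a≤t , b≡2l ← ∧-true spokeᵃ = to-top (≤ᵇ-true⇒≤ a≤t) (≡ᵇ-true⇒≡ b≡2l)
... | inj₂ spokeᵇ with b≤t , a≡2l ← ∧-true spokeᵇ = from-top (≤ᵇ-true⇒≤ b≤t) (≡ᵇ-true⇒≡ a≡2l)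

t≤l+t∸1 : ∀ {l} t → 0 < l → t ≤ l + t ∸ 1
t≤l+t∸1 {suc l} t _ = m≤n+m t l

top-neighbour≤ : ∀ {l t a b} → 0 < l → a ≡ 2 * l → FAdjℕ l t a b ≡ true → b ≤ t
top-neighbour≤ {suc l} {t} {_} {b} _ refl adj with FAdjℕ⇒F2lEdge (suc l) t _ b adj
... | band 2l≤2l∸1 _ = -- for l = suc l, 2 * l ∸ 1 < 2 * l holds definitionally
  contradiction 2l≤2l∸1 (<-irrefl refl)
... | to-top _ refl  = contradiction adj (FAdjℕ-irrefl (suc l) t b)
... | from-top b≤t _ = b≤t

spoke-neighbour≤ : ∀ {l t a b} → 0 < l → a ≤ t → FAdjℕ l t a b ≡ true → b ≤ l + t ∸ 1 ⊎ b ≡ 2 * l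
spoke-neighbour≤ {suc l} {t} {a} {b} 0<l a≤t adj with FAdjℕ⇒F2lEdge (suc l) t a b adj
... | band _ close = inj₁ (begin
  b              ≤⟨ m≤n+∣n-m∣ b a ⟩
  a + ∣ a - b ∣  ≤⟨ +-mono-≤ a≤t close ⟩
  t + l          ≡⟨ +-comm t l ⟩
  l + t          ∎)
  where open ≤-Reasoning
... | to-top _ b≡2l  = inj₂ b≡2l
... | from-top b≤t _ = inj₁ (≤-trans b≤t (t≤l+t∸1 t 0<l))

top-ball₂ : ∀ {l t} {z b : Fin (2 * l)} → 0 < l → label z ≡ 2 * l →
  DistLe (F2l l t) z b 2 → label b ≤ l + t ∸ 1 ⊎ label b ≡ 2 * l
top-ball₂ _ z-top (0 , _ , here) = inj₂ z-top
top-ball₂ {t = t} 0<l z-top (1 , _ , step z~b here) =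
  inj₁ (≤-trans (top-neighbour≤ 0<l z-top z~b) (t≤l+t∸1 t 0<l))
top-ball₂ 0<l z-top (2 , _ , step z~w (step w~b here)) =
  spoke-neighbour≤ 0<l (top-neighbour≤ 0<l z-top z~w) w~b
top-ball₂ _ _ (suc (suc (suc _)) , s≤s (s≤s ()) , _)

label-injective : ∀ {m} {i j : Fin m} → label i ≡ label j → i ≡ j
label-injective = toℕ-injective ∘ suc-injective

lemma4 : (F : Graph) → IsSimple F → Diameter2 F →
    (t : ℕ) → MinDegree F t →
    (l : ℕ) → size F < l →
    (Y : Subgraph (F2l l t)) → Iso F Y →
    (∃ λ (z : Fin (size (F2l l t))) → label z ≡ 2 * l × inV Y z ≡ true) →
    -- (1) edges (k,2l), 1 ≤ k ≤ t, lie in E(Y)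
    (∀ (a b : Fin (size (F2l l t))) → label a ≤ t → label b ≡ 2 * l → inE Y a b ≡ true)
    -- (2) Y is a subgraph of X = F_{2l}[{1,…,l+t-1} ∪ {2l}]
    × (∀ (a : Fin (size (F2l l t))) → inV Y a ≡ true → (label a ≤ l + t ∸ 1) ⊎ (label a ≡ 2 * l))
lemma4 F _ (within₂ , _) t (t≤degree , _) l n<l Y iso@(f , f-inj , _ , f-onto , f-preserves)
       (z , z-top , z∈Y) = spokes , inside
  where
  0<l : 0 < l
  0<l = m<n⇒0<n n<l
  u₀ : Fin (size F)
  u₀ = proj₁ (f-onto z z∈Y)
  fu₀-top : label (f u₀) ≡ 2 * l
  fu₀-top = trans (cong label (proj₂ (f-onto z z∈Y))) z-top
  hom : IsHomomorphism F (F2l l t) f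
  hom = Iso⇒IsHomomorphism {Y = Y} iso
  neighbour<t : ∀ {w} → w ∈ neighbours F u₀ → toℕ (f w) < t
  neighbour<t w∈N = top-neighbour≤ 0<l fu₀-top (hom (∈-neighbours⁻ {F} w∈N))
  spokes : ∀ a b → label a ≤ t → label b ≡ 2 * l → inE Y a b ≡ true
  spokes a b a≤t b-top
    with w , w∈N , refl ←
           injective-image-saturates f-inj (neighbours-unique F u₀) (t≤degree u₀) neighbour<t a a≤t
    with refl ← label-injective (trans b-top (sym fu₀-top))
    = trans (inE-sym Y (f w) (f u₀)) (trans (sym (f-preserves u₀ w)) (∈-neighbours⁻ {F} w∈N))
  inside : ∀ a → inV Y a ≡ true → label a ≤ l + t ∸ 1 ⊎ label a ≡ 2 * l
  inside a a∈Y with u , refl ← f-onto a a∈Y = top-ball₂ 0<l fu₀-top (DistLe-map hom (within₂ u₀ u))
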